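{- Let $s$ be a positive integer, let $(b_1,\dots,b_{s+1})$ and $(k_1,\dots,k_s)$ be sequences of non-negative integers with $1\leq k_i\leq b_1+\cdots+b_{s+1}$ for all $1\leq i\leq s$, and suppose there exist a permutation $w$ of $\{1,\dots,s\}$ and non-negative integers $t_1,\dots,t_s$ such that $k_{w(j)}-k_{w(j-1)}=b_{w(j)}+t_j$ for $1\leq j\leq s$ (with $k_0=w(0):=0$), $\sum_{j=1}^s t_j\leq b_{s+1}$, and $t_j>0$ whenever $w(j-1)<w(j)$. Let $m$ be a non-negative integer. Set $b_0=-\sum_{i=1}^{s+1}b_i$ and $x_i=q^{k_s-k_i}$ for $0\leq i\leq s$. Then the rational function of $q$ \[ -\sum_{i=0}^{s}\frac{1-q^{b_i}}{1-q}\,x_i\,q^{ -\chi(i<m)} \] equals $q^{n_1}+\cdots+q^{n_{b_{s+1}}}$ for some integers $n_1,\dots,n_{b_{s+1}}$ (determined by $m$, the $b_i$ and the $k_j$).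
   Context: $\chi$ denotes the truth function: $\chi(P)=1$ if the statement $P$ is true and $0$ otherwise. When $b_{s+1}=0$ the right-hand side is $0$. -}

module Defs where

open import Data.Nat as ℕ using (ℕ; zero; suc; _≤_; _<_)
open import Data.Integer as ℤ using (ℤ; +_; -_; _+_; _-_; 0ℤ; 1ℤ; -1ℤ)
open import Data.Bool using (Bool; if_then_else_; _∧_)
open import Data.Product using (∃; _×_)
open import Relation.Nullary.Decidable using (does)
open import Relation.Binary.PropositionalEquality using (_≡_)
open import Data.Vec using (Vec; []; _∷_)

-- A Laurent polynomial in q with integer coefficients, represented by its
-- coefficient function:  p e  is the coefficient of q^e.
-- (All Laurent polynomials below have finite support.)
LaurentPoly : Set
LaurentPoly = ℤ → ℤ

_⊕_ : LaurentPoly → LaurentPoly → LaurentPoly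
(p ⊕ r) e = p e + r e

⊖_ : LaurentPoly → LaurentPoly
(⊖ p) e = - p e

monomial : ℤ → LaurentPoly
monomial n e = if does (e ℤ.≟ n) then 1ℤ else 0ℤ

mulMonomial : ℤ → LaurentPoly → LaurentPoly
mulMonomial c p e = p (e - c)

-- the Laurent polynomial (1 - q^b)/(1 - q) for b ∈ ℤ:
--   b ≥ 0 :  1 + q + ... + q^(b-1)
--   b < 0 :  -(q^b + q^(b+1) + ... + q^(-1))
qInt : ℤ → LaurentPoly
qInt b e =
  if does (0ℤ ℤ.≤? e) ∧ does (e ℤ.<? b) then 1ℤ
  else if does (b ℤ.≤? e) ∧ does (e ℤ.<? 0ℤ) then -1ℤ
  else 0ℤ

bigSum : ℕ → (ℕ → LaurentPoly) → LaurentPoly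
bigSum zero f = f 0
bigSum (suc n) f = bigSum n f ⊕ f (suc n)

sumMonomials : {r : ℕ} → Vec ℤ r → LaurentPoly
sumMonomials [] e = 0ℤ
sumMonomials (n ∷ ns) = monomial n ⊕ sumMonomials ns

sum₁ : ℕ → (ℕ → ℕ) → ℕ
sum₁ zero f = 0
sum₁ (suc n) f = sum₁ n f ℕ.+ f (suc n)

χ< : ℕ → ℕ → ℤ
χ< i m = if does (i ℕ.<? m) then 1ℤ else 0ℤ

IsPermutation : ℕ → (ℕ → ℕ) → Set
IsPermutation s w =
  (∀ j → 1 ≤ j → j ≤ s → 1 ≤ w j × w j ≤ s)
  × (∀ i j → 1 ≤ i → i ≤ s → 1 ≤ j → j ≤ s → w i ≡ w j → i ≡ j)
  × (∀ i → 1 ≤ i → i ≤ s → ∃ λ j → 1 ≤ j × j ≤ s × w j ≡ i)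

bExt : ℕ → (ℕ → ℕ) → ℕ → ℤ
bExt s b zero = - (+ sum₁ (suc s) b)
bExt s b (suc i) = + b (suc i)

expr : ℕ → (ℕ → ℕ) → (ℕ → ℕ) → ℕ → LaurentPoly
expr s b k m =
  ⊖ bigSum s (λ i →
      mulMonomial ((+ k s - + k i) - χ< i m) (qInt (bExt s b i)))

module Submission where

-- Write c_i = (k_s - k_i) - χ(i<m), so that x_i q^{-χ(i<m)} = q^{c_i}, and
-- [a, a+n) for the interval polynomial q^a + q^(a+1) + ... + q^(a+n-1).
-- Since (1 - q^b)/(1 - q) is [0, b) for b ≥ 0 and -[b, 0) for b < 0, the
-- expression equals [c_0 - B, c_0) minus the blocks [c_i, c_i + b_i)
-- (1 ≤ i ≤ s), where B = b_1 + ... + b_{s+1}.  Taking the blocks in the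
-- order w(s), ..., w(1), the hypotheses on w and t say that block w(j) ends
-- a gap t_j + χ(w(j)<m) - χ(w(j-1)<m) ≥ 0 below the start of block w(j-1);
-- the last block is followed by c_{w(0)} = c_0, and the first starts at or
-- above c_0 - B because k_{w(s)} ≤ B.  So [c_0 - B, c_0) is tiled by the
-- blocks and the gaps, and the expression is the sum of the monomials in the
-- gaps; counting lengths, there are B - (b_1 + ... + b_s) = b_{s+1} of them.
-- Sections: finite sums over ℤ and their invariance under permutations;
-- interval polynomials, their splitting and shifting; (1 - q^b)/(1 - q) as
-- an interval; tilings by adjacent intervals; the arithmetic of χ; the
-- tiling described above; and the proposition.

open import Defs

module FiniteSums where

  open import Data.Nat as ℕ using (ℕ; zero; suc; z≤n; s≤s)
  import Data.Nat.Properties as ℕP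
  open import Data.Integer using (ℤ; +_; _+_; _*_; 0ℤ; 1ℤ)
  open import Data.Integer.Properties
    using ( +-assoc; +-identityˡ; +-identityʳ; *-identityˡ; *-identityʳ; *-zeroˡ; *-distribʳ-+; pos-+; +-injective
          ; +-commutativeSemigroup)
  open import Algebra.Properties.CommutativeSemigroup +-commutativeSemigroup using (interchange)
  open import Algebra.Properties.CommutativeSemigroup ℕP.+-commutativeSemigroup
    using () renaming (interchange to ℕ-interchange)
  open import Data.Bool using (if_then_else_)
  open import Data.Product using (_,_; proj₁; proj₂)
  open import Data.Sum using (inj₁; inj₂)
  open import Relation.Nullary using (yes; no)
  open import Relation.Nullary.Decidable using (does; dec-true; dec-false)
  open import Relation.Binary.PropositionalEquality
  open ≡-Reasoning

  Σℤ : ℕ → (ℕ → ℤ) → ℤ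
  Σℤ zero    f = 0ℤ
  Σℤ (suc n) f = Σℤ n f + f (suc n)

  Σ-cong : ∀ n {f g : ℕ → ℤ} → (∀ i → 1 ℕ.≤ i → i ℕ.≤ n → f i ≡ g i) → Σℤ n f ≡ Σℤ n g
  Σ-cong zero    f≗g = refl
  Σ-cong (suc n) f≗g =
    cong₂ _+_ (Σ-cong n λ i 1≤i i≤n → f≗g i 1≤i (ℕP.m≤n⇒m≤1+n i≤n))
              (f≗g (suc n) (s≤s z≤n) ℕP.≤-refl)

  Σ-zero : ∀ n → Σℤ n (λ _ → 0ℤ) ≡ 0ℤ
  Σ-zero zero    = refl
  Σ-zero (suc n) = trans (+-identityʳ _) (Σ-zero n)

  Σ-+ : ∀ n (f g : ℕ → ℤ) → Σℤ n (λ i → f i + g i) ≡ Σℤ n f + Σℤ n g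
  Σ-+ zero    f g = refl
  Σ-+ (suc n) f g =
    trans (cong (_+ (f (suc n) + g (suc n))) (Σ-+ n f g)) (interchange (Σℤ n f) (Σℤ n g) (f (suc n)) (g (suc n)))

  Σ-*ʳ : ∀ n (f : ℕ → ℤ) x → Σℤ n f * x ≡ Σℤ n (λ i → f i * x)
  Σ-*ʳ zero    f x = *-zeroˡ x
  Σ-*ʳ (suc n) f x =
    trans (*-distribʳ-+ x (Σℤ n f) (f (suc n))) (cong (_+ f (suc n) * x) (Σ-*ʳ n f x))

  Σ-swap : ∀ n p (h : ℕ → ℕ → ℤ) → Σℤ n (λ i → Σℤ p (h i)) ≡ Σℤ p (λ j → Σℤ n (λ i → h i j))
  Σ-swap zero    p h = sym (Σ-zero p)
  Σ-swap (suc n) p h = trans (cong (_+ Σℤ p (h (suc n))) (Σ-swap n p h)) (sym (Σ-+ p _ _))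

  bigSum-coefficient : ∀ n (F : ℕ → LaurentPoly) e → bigSum n F e ≡ F 0 e + Σℤ n (λ i → F i e)
  bigSum-coefficient zero    F e = sym (+-identityʳ _)
  bigSum-coefficient (suc n) F e =
    trans (cong (_+ F (suc n) e) (bigSum-coefficient n F e)) (+-assoc (F 0 e) _ _)

  sum₁-pos : ∀ n (f : ℕ → ℕ) → + sum₁ n f ≡ Σℤ n (λ i → + f i)
  sum₁-pos zero    f = refl
  sum₁-pos (suc n) f = trans (pos-+ (sum₁ n f) (f (suc n))) (cong (_+ + f (suc n)) (sum₁-pos n f))

  sum₁-+ : ∀ n (f g : ℕ → ℕ) → sum₁ n (λ i → f i ℕ.+ g i) ≡ sum₁ n f ℕ.+ sum₁ n g
  sum₁-+ zero    f g = refl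
  sum₁-+ (suc n) f g =
    trans (cong (ℕ._+ (f (suc n) ℕ.+ g (suc n))) (sum₁-+ n f g)) (ℕ-interchange (sum₁ n f) (sum₁ n g) (f (suc n)) (g (suc n)))

  δ : ℕ → ℕ → ℤ
  δ i j = if does (i ℕ.≟ j) then 1ℤ else 0ℤ

  δ-refl : ∀ i → δ i i ≡ 1ℤ
  δ-refl i = cong (if_then 1ℤ else 0ℤ) (dec-true (i ℕ.≟ i) refl)

  δ-≢ : ∀ {i j} → i ≢ j → δ i j ≡ 0ℤ
  δ-≢ {i} {j} i≢j = cong (if_then 1ℤ else 0ℤ) (dec-false (i ℕ.≟ j) i≢j)

  select-beyond : ∀ n c (g : ℕ → ℤ) → n ℕ.< c → Σℤ n (λ i → δ c i * g i) ≡ 0ℤ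
  select-beyond n c g n<c = trans (Σ-cong n vanish) (Σ-zero n)
    where
    vanish : ∀ i → 1 ℕ.≤ i → i ℕ.≤ n → δ c i * g i ≡ 0ℤ
    vanish i _ i≤n =
      trans (cong (_* g i) (δ-≢ λ c≡i → ℕP.<⇒≢ (ℕP.≤-<-trans i≤n n<c) (sym c≡i))) (*-zeroˡ (g i))

  select : ∀ n c (g : ℕ → ℤ) → 1 ℕ.≤ c → c ℕ.≤ n → Σℤ n (λ i → δ c i * g i) ≡ g c
  select zero    (suc c) g _ ()
  select (suc n) c g 1≤c c≤1+n with ℕP.m≤n⇒m<n∨m≡n c≤1+n
  ... | inj₂ refl = begin
      Σℤ n (λ i → δ c i * g i) + δ c c * g c ≡⟨ cong₂ _+_ (select-beyond n c g ℕP.≤-refl) (cong (_* g c) (δ-refl c)) ⟩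
      0ℤ + 1ℤ * g c                          ≡⟨ trans (+-identityˡ _) (*-identityˡ _) ⟩
      g c                                     ∎
  ... | inj₁ c<1+n = begin
      Σℤ n (λ i → δ c i * g i) + δ c (suc n) * g (suc n)
        ≡⟨ cong₂ _+_ (select n c g 1≤c (ℕP.≤-pred c<1+n)) (cong (_* g (suc n)) (δ-≢ (ℕP.<⇒≢ c<1+n))) ⟩
      g c + 0ℤ * g (suc n)
        ≡⟨ +-identityʳ _ ⟩
      g c ∎

  -- A sum over [1, s] is invariant under a permutation w of [1, s]:
  -- Σ_i g(i) = Σ_i Σ_j δ(w j, i) g(i) = Σ_j Σ_i δ(w j, i) g(i) = Σ_j g(w j).
  module _ {s : ℕ} {w : ℕ → ℕ} (perm : IsPermutation s w) where

    private
      w-range = proj₁ perm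
      w-injective = proj₁ (proj₂ perm)
      w-surjective = proj₂ (proj₂ perm)

    preimage-count : ∀ i → 1 ℕ.≤ i → i ℕ.≤ s → Σℤ s (λ j → δ (w j) i) ≡ 1ℤ
    preimage-count i 1≤i i≤s with w-surjective i 1≤i i≤s
    ... | j₀ , 1≤j₀ , j₀≤s , wj₀≡i =
      trans (Σ-cong s λ j 1≤j j≤s → trans (only-j₀ j 1≤j j≤s) (sym (*-identityʳ _)))
            (select s j₀ (λ _ → 1ℤ) 1≤j₀ j₀≤s)
      where
      only-j₀ : ∀ j → 1 ℕ.≤ j → j ℕ.≤ s → δ (w j) i ≡ δ j₀ j
      only-j₀ j 1≤j j≤s with j₀ ℕ.≟ j
      ... | yes refl = trans (cong (λ x → δ x i) wj₀≡i) (trans (δ-refl i) (sym (δ-refl j₀)))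
      ... | no j₀≢j  = trans (δ-≢ λ wj≡i → j₀≢j (w-injective j₀ j 1≤j₀ j₀≤s 1≤j j≤s (trans wj₀≡i (sym wj≡i))))
                             (sym (δ-≢ j₀≢j))

    reindex : ∀ (g : ℕ → ℤ) → Σℤ s (λ j → g (w j)) ≡ Σℤ s g
    reindex g = sym (begin
        Σℤ s g
      ≡⟨ Σ-cong s (λ i 1≤i i≤s → sym (trans (cong (_* g i) (preimage-count i 1≤i i≤s)) (*-identityˡ _))) ⟩
        Σℤ s (λ i → Σℤ s (λ j → δ (w j) i) * g i)
      ≡⟨ Σ-cong s (λ i _ _ → Σ-*ʳ s (λ j → δ (w j) i) (g i)) ⟩
        Σℤ s (λ i → Σℤ s (λ j → δ (w j) i * g i))
      ≡⟨ Σ-swap s s (λ i j → δ (w j) i * g i) ⟩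
        Σℤ s (λ j → Σℤ s (λ i → δ (w j) i * g i))
      ≡⟨ Σ-cong s (λ j 1≤j j≤s → select s (w j) g (proj₁ (w-range j 1≤j j≤s)) (proj₂ (w-range j 1≤j j≤s))) ⟩
        Σℤ s (λ j → g (w j))
      ∎)

    reindex-sum₁ : ∀ (f : ℕ → ℕ) → sum₁ s (λ j → f (w j)) ≡ sum₁ s f
    reindex-sum₁ f = +-injective (trans (sum₁-pos s (λ j → f (w j))) (trans (reindex (λ i → + f i)) (sym (sum₁-pos s f))))

module Intervals where

  open import Data.Nat as ℕ using (ℕ; zero; suc)
  open import Data.Integer using (ℤ; +_; _+_; _-_; _≤_; _<_; _≟_; 0ℤ; 1ℤ) renaming (suc to 1+_)
  open import Data.Integer.Properties
    using ( +-assoc; +-identityˡ; +-identityʳ; <-irrefl; <-trans; ≤⇒≯; ≤∧≢⇒<; i≤i+j; i<j⇒suc[i]≤j; suc[i]≤j⇒i<j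
          ; ≤-refl; +-commutativeSemigroup)
  open import Algebra.Properties.CommutativeSemigroup +-commutativeSemigroup using (x∙yz≈y∙xz)
  open import Data.Integer.Tactic.RingSolver using (solve-∀)
  open import Data.Bool using (if_then_else_)
  open import Data.Vec using (Vec; []; _∷_; _++_)
  open import Data.Product using (Σ-syntax; _,_)
  open import Data.Sum using (_⊎_; inj₁; inj₂)
  open import Function using (case_of_)
  open import Relation.Nullary using (yes; no; contradiction)
  open import Relation.Nullary.Decidable using (dec-true; dec-false)
  open import Relation.Binary.PropositionalEquality

  exponentsFrom : ℤ → (n : ℕ) → Vec ℤ n
  exponentsFrom a zero    = []
  exponentsFrom a (suc n) = a ∷ exponentsFrom (1+ a) n

  interval : ℤ → ℕ → LaurentPoly
  interval a n = sumMonomials (exponentsFrom a n)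

  monomial-≡ : ∀ {a e} → e ≡ a → monomial a e ≡ 1ℤ
  monomial-≡ {a} {e} e≡a = cong (if_then 1ℤ else 0ℤ) (dec-true (e ≟ a) e≡a)

  monomial-≢ : ∀ {a e} → e ≢ a → monomial a e ≡ 0ℤ
  monomial-≢ {a} {e} e≢a = cong (if_then 1ℤ else 0ℤ) (dec-false (e ≟ a) e≢a)

  sumMonomials-++ : ∀ {p r} (xs : Vec ℤ p) (ys : Vec ℤ r) e
    → sumMonomials (xs ++ ys) e ≡ sumMonomials xs e + sumMonomials ys e
  sumMonomials-++ []       ys e = sym (+-identityˡ _)
  sumMonomials-++ (x ∷ xs) ys e =
    trans (cong (λ z → monomial x e + z) (sumMonomials-++ xs ys e)) (sym (+-assoc (monomial x e) _ _))

  1+-slide : ∀ a n → (1+ a) + + n ≡ a + + suc n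
  1+-slide a n = trans (+-assoc 1ℤ a (+ n)) (x∙yz≈y∙xz 1ℤ a (+ n))

  a<1+a : ∀ a → a < 1+ a
  a<1+a a = suc[i]≤j⇒i<j ≤-refl

  a<a+1+n : ∀ a n → a < a + + suc n
  a<a+1+n a n = suc[i]≤j⇒i<j (subst (1+ a ≤_) (1+-slide a n) (i≤i+j (1+ a) (+ n)))

  exponentsFrom-++ : ∀ a m n → exponentsFrom a (m ℕ.+ n) ≡ exponentsFrom a m ++ exponentsFrom (a + + m) n
  exponentsFrom-++ a zero    n = cong (λ x → exponentsFrom x n) (sym (+-identityʳ a))
  exponentsFrom-++ a (suc m) n = cong (a ∷_) (trans (exponentsFrom-++ (1+ a) m n)
    (cong (λ x → exponentsFrom (1+ a) m ++ exponentsFrom x n) (1+-slide a m)))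

  interval-split : ∀ a m n e → interval a (m ℕ.+ n) e ≡ interval a m e + interval (a + + m) n e
  interval-split a m n e =
    trans (cong (λ v → sumMonomials v e) (exponentsFrom-++ a m n)) (sumMonomials-++ (exponentsFrom a m) _ e)

  interval-outside : ∀ n {a e} → e < a ⊎ a + + n ≤ e → interval a n e ≡ 0ℤ
  interval-outside zero    _   = refl
  interval-outside (suc n) {a} {e} out =
    cong₂ _+_ (monomial-≢ (e≢a out)) (interval-outside n (next out))
    where
    e≢a : e < a ⊎ a + + suc n ≤ e → e ≢ a
    e≢a (inj₁ e<a) e≡a = <-irrefl e≡a e<a
    e≢a (inj₂ a+n≤a) refl = ≤⇒≯ a+n≤a (a<a+1+n a n)
    next : e < a ⊎ a + + suc n ≤ e → e < 1+ a ⊎ 1+ a + + n ≤ e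
    next (inj₁ e<a)   = inj₁ (<-trans e<a (a<1+a a))
    next (inj₂ a+n≤e) = inj₂ (subst (_≤ e) (sym (1+-slide a n)) a+n≤e)

  interval-inside : ∀ n {a e} → a ≤ e → e < a + + n → interval a n e ≡ 1ℤ
  interval-inside zero    {a} {e} a≤e e<a+0 = contradiction (subst (e <_) (+-identityʳ a) e<a+0) (≤⇒≯ a≤e)
  interval-inside (suc n) {a} {e} a≤e e<a+n = case e ≟ a of λ where
      (yes e≡a) → cong₂ _+_ (monomial-≡ e≡a) (interval-outside n (inj₁ (subst (_< 1+ a) (sym e≡a) (a<1+a a))))
      (no e≢a)  → cong₂ _+_ (monomial-≢ e≢a) (interval-inside n (1+a≤e e≢a) (subst (e <_) (sym (1+-slide a n)) e<a+n))
    where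
    1+a≤e : e ≢ a → 1+ a ≤ e
    1+a≤e e≢a = i<j⇒suc[i]≤j (≤∧≢⇒< a≤e λ a≡e → e≢a (sym a≡e))

  monomial-shift : ∀ a c e → mulMonomial c (monomial a) e ≡ monomial (a + c) e
  monomial-shift a c e = case e ≟ a + c of λ where
      (yes e≡a+c) → trans (monomial-≡ (trans (cong (_- c) e≡a+c) (a+c-c≡a a c))) (sym (monomial-≡ e≡a+c))
      (no e≢a+c)  → trans (monomial-≢ {a} {e - c} λ e-c≡a → e≢a+c (trans (sym (e-c+c≡e e c)) (cong (_+ c) e-c≡a)))
                          (sym (monomial-≢ e≢a+c))
    where
    a+c-c≡a : ∀ a c → (a + c) - c ≡ a
    a+c-c≡a = solve-∀
    e-c+c≡e : ∀ e c → (e - c) + c ≡ e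
    e-c+c≡e = solve-∀

  interval-shift : ∀ a n c e → mulMonomial c (interval a n) e ≡ interval (a + c) n e
  interval-shift a zero    c e = refl
  interval-shift a (suc n) c e =
    cong₂ _+_ (monomial-shift a c e)
              (trans (interval-shift (1+ a) n c e) (cong (λ x → interval x n e) (+-assoc 1ℤ a c)))

  resize : ∀ {n r} → n ≡ r → (p : LaurentPoly) (v : Vec ℤ n)
    → (∀ e → p e ≡ sumMonomials v e) → Σ[ v′ ∈ Vec ℤ r ] (∀ e → p e ≡ sumMonomials v′ e)
  resize refl p v p≡v = v , p≡v

module QInteger where

  open import Data.Nat using (z≤n)
  open import Data.Integer using (ℤ; +_; -_; _+_; _-_; _≤_; _<_; _≤?_; _<?_; 0ℤ; 1ℤ; -1ℤ; +≤+)
  open import Data.Integer.Properties using (≤-trans; ≤⇒≯; ≰⇒>; ≮⇒≥; neg-≤-pos; +-identityˡ; +-inverseˡ)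
  open import Data.Product using (_×_; _,_; _,′_)
  open import Data.Sum using (inj₁; inj₂)
  open import Function using (case_of_)
  open import Relation.Nullary using (¬_; yes; no; contradiction)
  open import Relation.Binary.PropositionalEquality
  open Intervals

  qInt-positive : ∀ {b x} → 0ℤ ≤ x → x < b → qInt b x ≡ 1ℤ
  qInt-positive {b} {x} 0≤x x<b with 0ℤ ≤? x | x <? b
  ... | yes _   | yes _   = refl
  ... | no 0≰x  | _       = contradiction 0≤x 0≰x
  ... | yes _   | no x≮b  = contradiction x<b x≮b

  qInt-negative : ∀ {b x} → b ≤ x → x < 0ℤ → qInt b x ≡ -1ℤ
  qInt-negative {b} {x} b≤x x<0 with 0ℤ ≤? x | x <? b | b ≤? x | x <? 0ℤ
  ... | yes 0≤x | _ | _      | _      = contradiction x<0 (≤⇒≯ 0≤x)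
  ... | no _    | _ | no b≰x | _      = contradiction b≤x b≰x
  ... | no _    | _ | yes _  | no x≮0 = contradiction x<0 x≮0
  ... | no _    | _ | yes _  | yes _  = refl

  qInt-vanishes : ∀ {b x} → ¬ (0ℤ ≤ x × x < b) → ¬ (b ≤ x × x < 0ℤ) → qInt b x ≡ 0ℤ
  qInt-vanishes {b} {x} ¬pos ¬neg with 0ℤ ≤? x | x <? b | b ≤? x | x <? 0ℤ
  ... | yes 0≤x | yes x<b | _       | _       = contradiction (0≤x , x<b) ¬pos
  ... | yes _   | no _    | yes b≤x | yes x<0 = contradiction (b≤x , x<0) ¬neg
  ... | no _    | _       | yes b≤x | yes x<0 = contradiction (b≤x , x<0) ¬neg
  ... | yes _   | no _    | yes _   | no _    = refl
  ... | yes _   | no _    | no _    | _       = refl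
  ... | no _    | _       | yes _   | no _    = refl
  ... | no _    | _       | no _    | _       = refl

  qInt-natural : ∀ n x → qInt (+ n) x ≡ interval 0ℤ n x
  qInt-natural n x = case ((0ℤ ≤? x) ,′ (x <? + n)) of λ where
      (yes 0≤x , yes x<n) → trans (qInt-positive 0≤x x<n) (sym (interval-inside n 0≤x x<n))
      (no 0≰x , _)        → trans (qInt-vanishes (λ (0≤x , _) → 0≰x 0≤x) (λ (n≤x , _) → 0≰x (≤-trans (+≤+ z≤n) n≤x)))
                                  (sym (interval-outside n (inj₁ (≰⇒> 0≰x))))
      (yes 0≤x , no x≮n)  → trans (qInt-vanishes (λ (_ , x<n) → x≮n x<n) (λ (_ , x<0) → ≤⇒≯ 0≤x x<0))
                                  (sym (interval-outside n (inj₂ (≮⇒≥ x≮n))))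

  qInt-negated : ∀ n x → qInt (- + n) x ≡ - interval (- + n) n x
  qInt-negated n x = case ((- + n ≤? x) ,′ (x <? 0ℤ)) of λ where
      (yes -n≤x , yes x<0) → trans (qInt-negative -n≤x x<0)
                                   (sym (cong -_ (interval-inside n -n≤x (subst (x <_) (sym (+-inverseˡ (+ n))) x<0))))
      (no -n≰x , _)        → trans (qInt-vanishes (λ (0≤x , _) → -n≰x (≤-trans neg-≤-pos 0≤x)) (λ (-n≤x , _) → -n≰x -n≤x))
                                   (sym (cong -_ (interval-outside n (inj₁ (≰⇒> -n≰x)))))
      (yes -n≤x , no x≮0)  → trans (qInt-vanishes (λ (_ , x<-n) → ≤⇒≯ -n≤x x<-n) (λ (_ , x<0) → x≮0 x<0))
                                   (sym (cong -_ (interval-outside n (inj₂ (subst (_≤ x) (sym (+-inverseˡ (+ n))) (≮⇒≥ x≮0))))))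

  qInt-natural-shifted : ∀ n c e → mulMonomial c (qInt (+ n)) e ≡ interval c n e
  qInt-natural-shifted n c e =
    trans (qInt-natural n (e - c)) (trans (interval-shift 0ℤ n c e) (cong (λ a → interval a n e) (+-identityˡ c)))

  qInt-negated-shifted : ∀ n c e → mulMonomial c (qInt (- + n)) e ≡ - interval (- + n + c) n e
  qInt-negated-shifted n c e = trans (qInt-negated n (e - c)) (cong -_ (interval-shift (- + n) n c e))

module Tiling where

  open import Data.Nat as ℕ using (ℕ; zero; suc)
  import Data.Nat.Properties as ℕP
  open import Data.Integer using (ℤ; +_; _+_)
  open import Data.Integer.Properties using (+-comm; +-identityʳ; pos-+; +-commutativeSemigroup)
  open import Algebra.Properties.CommutativeSemigroup +-commutativeSemigroup using (x∙yz≈xz∙y)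
  open import Relation.Binary.PropositionalEquality
  open ≡-Reasoning
  open FiniteSums using (Σℤ)
  open Intervals using (interval; interval-split)

  Adjacent : (u : ℕ → ℤ) (len : ℕ → ℕ) → ℕ → Set
  Adjacent u len n = ∀ j → j ℕ.< n → u (suc j) + + len (suc j) ≡ u j

  module _ (u : ℕ → ℤ) (len : ℕ → ℕ) where

    adjacent-pred : ∀ {n} → Adjacent u len (suc n) → Adjacent u len n
    adjacent-pred adj j j<n = adj j (ℕP.m<n⇒m<1+n j<n)

    tiling-end : ∀ n → Adjacent u len n → u n + + sum₁ n len ≡ u 0
    tiling-end zero    _   = +-identityʳ (u 0)
    tiling-end (suc n) adj = begin
        u (suc n) + + (sum₁ n len ℕ.+ len (suc n))
      ≡⟨ cong (λ l → u (suc n) + l) (pos-+ (sum₁ n len) (len (suc n))) ⟩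
        u (suc n) + (+ sum₁ n len + + len (suc n))
      ≡⟨ x∙yz≈xz∙y (u (suc n)) _ _ ⟩
        (u (suc n) + + len (suc n)) + + sum₁ n len
      ≡⟨ cong (_+ + sum₁ n len) (adj n (ℕP.n<1+n n)) ⟩
        u n + + sum₁ n len
      ≡⟨ tiling-end n (adjacent-pred adj) ⟩
        u 0
      ∎

    tiling : ∀ n → Adjacent u len n → ∀ e → interval (u n) (sum₁ n len) e ≡ Σℤ n (λ j → interval (u j) (len j) e)
    tiling zero    _   e = refl
    tiling (suc n) adj e = begin
        interval (u (suc n)) (sum₁ n len ℕ.+ len (suc n)) e
      ≡⟨ cong (λ l → interval (u (suc n)) l e) (ℕP.+-comm (sum₁ n len) (len (suc n))) ⟩
        interval (u (suc n)) (len (suc n) ℕ.+ sum₁ n len) e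
      ≡⟨ interval-split (u (suc n)) (len (suc n)) (sum₁ n len) e ⟩
        interval (u (suc n)) (len (suc n)) e + interval (u (suc n) + + len (suc n)) (sum₁ n len) e
      ≡⟨ cong (λ a → interval (u (suc n)) (len (suc n)) e + interval a (sum₁ n len) e) (adj n (ℕP.n<1+n n)) ⟩
        interval (u (suc n)) (len (suc n)) e + interval (u n) (sum₁ n len) e
      ≡⟨ cong (λ r → interval (u (suc n)) (len (suc n)) e + r) (tiling n (adjacent-pred adj) e) ⟩
        interval (u (suc n)) (len (suc n)) e + Σℤ n (λ j → interval (u j) (len j) e)
      ≡⟨ +-comm (interval (u (suc n)) (len (suc n)) e) _ ⟩
        Σℤ n (λ j → interval (u j) (len j) e) + interval (u (suc n)) (len (suc n)) e
      ∎

module Indicator where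

  open import Data.Nat as ℕ using (ℕ; suc; z≤n)
  import Data.Nat.Properties as ℕP
  open import Data.Integer using (ℤ; +_; _+_; _-_; _≤_; 0ℤ; 1ℤ; -1ℤ; +≤+)
  open import Data.Bool using (if_then_else_)
  open import Relation.Nullary using (¬_; yes; no; contradiction)
  open import Relation.Nullary.Decidable using (dec-true; dec-false)
  open import Relation.Binary.PropositionalEquality

  χ<-yes : ∀ {i m} → i ℕ.< m → χ< i m ≡ 1ℤ
  χ<-yes {i} {m} i<m = cong (if_then 1ℤ else 0ℤ) (dec-true (i ℕ.<? m) i<m)

  χ<-no : ∀ {i m} → ¬ i ℕ.< m → χ< i m ≡ 0ℤ
  χ<-no {i} {m} i≮m = cong (if_then 1ℤ else 0ℤ) (dec-false (i ℕ.<? m) i≮m)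

  χ<-antitone : ∀ {i j} m → i ℕ.≤ j → 0ℤ ≤ χ< i m - χ< j m
  χ<-antitone {i} {j} m i≤j with i ℕ.<? m | j ℕ.<? m
  ... | no i≮m  | yes j<m = contradiction (ℕP.≤-<-trans i≤j j<m) i≮m
  ... | yes i<m | yes j<m rewrite χ<-yes i<m | χ<-yes j<m = +≤+ z≤n
  ... | yes i<m | no j≮m  rewrite χ<-yes i<m | χ<-no j≮m  = +≤+ z≤n
  ... | no i≮m  | no j≮m  rewrite χ<-no i≮m  | χ<-no j≮m  = +≤+ z≤n

  χ<-step : ∀ t {x y} m → (y ℕ.< x → 0 ℕ.< t) → 0ℤ ≤ + t + (χ< x m - χ< y m)
  χ<-step t {x} {y} m ascent with x ℕ.<? m | y ℕ.<? m
  ... | no x≮m  | yes y<m rewrite χ<-no x≮m  | χ<-yes y<m = t-1≥0 (ascent (ℕP.<-≤-trans y<m (ℕP.≮⇒≥ x≮m)))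
    where
    t-1≥0 : ∀ {t} → 0 ℕ.< t → 0ℤ ≤ + t + -1ℤ
    t-1≥0 {suc t} _ = +≤+ z≤n
  ... | yes x<m | yes y<m rewrite χ<-yes x<m | χ<-yes y<m = +≤+ z≤n
  ... | yes x<m | no y≮m  rewrite χ<-yes x<m | χ<-no y≮m  = +≤+ z≤n
  ... | no x≮m  | no y≮m  rewrite χ<-no x≮m  | χ<-no y≮m  = +≤+ z≤n

module Proposition where

  open import Data.Nat as ℕ using (ℕ; zero; suc; z≤n; s≤s)
  import Data.Nat.Properties as ℕP
  open import Data.Integer using (ℤ; +_; -_; _+_; _-_; _≤_; 0ℤ; +≤+; ∣_∣)
  open import Data.Integer.Properties
    using (+-assoc; pos-+; +-injective; 0≤i⇒+∣i∣≡i; i≤j⇒0≤j-i; +-mono-≤; +-0-abelianGroup)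
  open import Algebra.Properties.AbelianGroup +-0-abelianGroup using (∙-cancelˡ)
  open import Algebra.Properties.CommutativeSemigroup ℕP.+-commutativeSemigroup using (x∙yz≈y∙xz)
  open import Data.Integer.Tactic.RingSolver using (solve-∀)
  open import Data.Product using (_×_; proj₁; proj₂)
  open import Data.Vec using (Vec; []; _++_)
  open import Relation.Binary.PropositionalEquality
  open ≡-Reasoning
  open FiniteSums
  open Intervals
  open QInteger
  open Tiling
  open Indicator

  x+[y-x]≡y : ∀ x y → x + (y - x) ≡ y
  x+[y-x]≡y = solve-∀

  module Proof
    (s : ℕ) (1≤s : 1 ℕ.≤ s) (b k t w : ℕ → ℕ)
    (k-bound : ∀ i → 1 ℕ.≤ i → i ℕ.≤ s → 1 ℕ.≤ k i × k i ℕ.≤ sum₁ (suc s) b)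
    (w0 : w 0 ≡ 0) (perm : IsPermutation s w)
    (steps : ∀ j → 1 ℕ.≤ j → j ℕ.≤ s → (+ k (w j)) - (+ k (w (j ℕ.∸ 1))) ≡ + (b (w j) ℕ.+ t j))
    (ascent : ∀ j → 1 ℕ.≤ j → j ℕ.≤ s → w (j ℕ.∸ 1) ℕ.< w j → 0 ℕ.< t j)
    (m : ℕ) where

    B : ℕ
    B = sum₁ (suc s) b

    c : ℕ → ℤ
    c i = (+ k s - + k i) - χ< i m

    u : ℕ → ℤ
    u j = c (w j)

    β : ℕ → ℕ
    β j = b (w j)

    block : ℕ → LaurentPoly
    block j = interval (u j) (β j)

    -- the 0-th summand is -[start, c 0)
    start : ℤ
    start = - + B + c 0

    gap : ℕ → ℕ
    gap zero    = 0
    gap (suc j) = ∣ u j - (u (suc j) + + β (suc j)) ∣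

    filler : ℕ → LaurentPoly
    filler j = interval (u j + + β j) (gap j)

    head : ℕ
    head = ∣ u s - start ∣

    len : ℕ → ℕ
    len j = β j ℕ.+ gap j

    gap-value : ∀ j → j ℕ.< s
      → u j - (u (suc j) + + β (suc j)) ≡ + t (suc j) + (χ< (w (suc j)) m - χ< (w j) m)
    gap-value j j<s = begin
        u j - (u (suc j) + + β (suc j))
      ≡⟨ regroup (+ k s) (+ k (w j)) (+ k (w (suc j))) (χ< (w j) m) (χ< (w (suc j)) m) (+ β (suc j)) ⟩
        ((+ k (w (suc j)) - + k (w j)) - + β (suc j)) + χ-change
      ≡⟨ cong (λ d → (d - + β (suc j)) + χ-change) (trans (steps (suc j) (s≤s z≤n) j<s) (pos-+ (β (suc j)) (t (suc j)))) ⟩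
        ((+ β (suc j) + + t (suc j)) - + β (suc j)) + χ-change
      ≡⟨ cong (_+ χ-change) (x+y-x≡y (+ β (suc j)) (+ t (suc j))) ⟩
        + t (suc j) + χ-change
      ∎
      where
      χ-change : ℤ
      χ-change = χ< (w (suc j)) m - χ< (w j) m
      regroup : ∀ K P Q χP χQ β → ((K - P) - χP) - (((K - Q) - χQ) + β) ≡ ((Q - P) - β) + (χQ - χP)
      regroup = solve-∀
      x+y-x≡y : ∀ x y → (x + y) - x ≡ y
      x+y-x≡y = solve-∀

    gap-exact : Adjacent u len s
    gap-exact j j<s = begin
        u (suc j) + + (β (suc j) ℕ.+ gap (suc j))
      ≡⟨ cong (λ l → u (suc j) + l) (pos-+ (β (suc j)) (gap (suc j))) ⟩
        u (suc j) + (+ β (suc j) + + gap (suc j))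
      ≡⟨ sym (+-assoc (u (suc j)) _ _) ⟩
        (u (suc j) + + β (suc j)) + + gap (suc j)
      ≡⟨ cong (λ g → (u (suc j) + + β (suc j)) + g) (0≤i⇒+∣i∣≡i gap-nonneg) ⟩
        (u (suc j) + + β (suc j)) + (u j - (u (suc j) + + β (suc j)))
      ≡⟨ x+[y-x]≡y (u (suc j) + + β (suc j)) (u j) ⟩
        u j
      ∎
      where
      gap-nonneg : 0ℤ ≤ u j - (u (suc j) + + β (suc j))
      gap-nonneg = subst (0ℤ ≤_) (sym (gap-value j j<s)) (χ<-step (t (suc j)) m (ascent (suc j) (s≤s z≤n) j<s))

    -- the lowest block starts at or above start, since k_{w s} ≤ B and χ(0<m) ≥ χ(w s < m)
    head-exact : start + + head ≡ u s
    head-exact = trans (cong (λ h → start + h) (0≤i⇒+∣i∣≡i head-nonneg)) (x+[y-x]≡y start (u s))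
      where
      k[ws]≤B : k (w s) ℕ.≤ B
      k[ws]≤B = proj₂ (k-bound (w s) (proj₁ ws-range) (proj₂ ws-range))
        where ws-range = proj₁ perm s 1≤s ℕP.≤-refl
      regroup : ∀ K P Q χP χQ B → ((K - P) - χP) - (- B + ((K - Q) - χQ)) ≡ ((B - P) + Q) + (χQ - χP)
      regroup = solve-∀
      head-nonneg : 0ℤ ≤ u s - start
      head-nonneg =
        subst (0ℤ ≤_) (sym (regroup (+ k s) (+ k (w s)) (+ k 0) (χ< (w s) m) (χ< 0 m) (+ B)))
          (+-mono-≤ (+-mono-≤ (i≤j⇒0≤j-i (+≤+ k[ws]≤B)) (+≤+ z≤n)) (χ<-antitone m z≤n))

    length-total : B ≡ head ℕ.+ sum₁ s len
    length-total = +-injective (∙-cancelˡ start (+ B) (+ (head ℕ.+ sum₁ s len)) (begin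
        start + + B                       ≡⟨ start+B≡c0 (+ B) (c 0) ⟩
        c 0                               ≡⟨ cong c (sym w0) ⟩
        u 0                               ≡⟨ sym (tiling-end u len s gap-exact) ⟩
        u s + + sum₁ s len                ≡⟨ cong (_+ + sum₁ s len) (sym head-exact) ⟩
        (start + + head) + + sum₁ s len   ≡⟨ +-assoc start (+ head) _ ⟩
        start + (+ head + + sum₁ s len)   ≡⟨ cong (λ l → start + l) (sym (pos-+ head (sum₁ s len))) ⟩
        start + + (head ℕ.+ sum₁ s len)   ∎))
      where
      start+B≡c0 : ∀ B c → (- B + c) + B ≡ c
      start+B≡c0 = solve-∀

    bottom-tiling : ∀ e → interval start B e ≡ interval start head e + (Σℤ s (λ j → block j e) + Σℤ s (λ j → filler j e))
    bottom-tiling e = begin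
        interval start B e
      ≡⟨ cong (λ l → interval start l e) length-total ⟩
        interval start (head ℕ.+ sum₁ s len) e
      ≡⟨ interval-split start head (sum₁ s len) e ⟩
        interval start head e + interval (start + + head) (sum₁ s len) e
      ≡⟨ cong (λ a → interval start head e + interval a (sum₁ s len) e) head-exact ⟩
        interval start head e + interval (u s) (sum₁ s len) e
      ≡⟨ cong (λ r → interval start head e + r) (tiling u len s gap-exact e) ⟩
        interval start head e + Σℤ s (λ j → interval (u j) (len j) e)
      ≡⟨ cong (λ r → interval start head e + r)
              (trans (Σ-cong s λ j _ _ → interval-split (u j) (β j) (gap j) e) (Σ-+ s _ _)) ⟩
        interval start head e + (Σℤ s (λ j → block j e) + Σℤ s (λ j → filler j e))
      ∎

    -- the blocks cancel, leaving the head and the gaps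
    expr-fillers : ∀ e → expr s b k m e ≡ interval start head e + Σℤ s (λ j → filler j e)
    expr-fillers e = begin
        - bigSum s F e
      ≡⟨ cong -_ (bigSum-coefficient s F e) ⟩
        - (F 0 e + Σℤ s (λ i → F i e))
      ≡⟨ cong₂ (λ x y → - (x + y)) (qInt-negated-shifted B (c 0) e) summands ⟩
        - (- interval start B e + Σℤ s (λ j → block j e))
      ≡⟨ cong (λ z → - (- z + Σℤ s (λ j → block j e))) (bottom-tiling e) ⟩
        - (- (interval start head e + (Σℤ s (λ j → block j e) + Σℤ s (λ j → filler j e))) + Σℤ s (λ j → block j e))
      ≡⟨ cancel-blocks (interval start head e) (Σℤ s (λ j → block j e)) (Σℤ s (λ j → filler j e)) ⟩
        interval start head e + Σℤ s (λ j → filler j e)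
      ∎
      where
      F : ℕ → LaurentPoly
      F i = mulMonomial (c i) (qInt (bExt s b i))
      summands : Σℤ s (λ i → F i e) ≡ Σℤ s (λ j → block j e)
      summands = trans (Σ-cong s λ { (suc i) _ _ → qInt-natural-shifted (b (suc i)) (c (suc i)) e })
                       (sym (reindex perm (λ i → interval (c i) (b i) e)))
      cancel-blocks : ∀ H X Y → - (- (H + (X + Y)) + X) ≡ H + Y
      cancel-blocks = solve-∀

    fillerExponents : (j : ℕ) → Vec ℤ (sum₁ j gap)
    fillerExponents zero    = []
    fillerExponents (suc j) = fillerExponents j ++ exponentsFrom (u (suc j) + + β (suc j)) (gap (suc j))

    fillerExponents-sum : ∀ j e → sumMonomials (fillerExponents j) e ≡ Σℤ j (λ i → filler i e)
    fillerExponents-sum zero    e = refl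
    fillerExponents-sum (suc j) e =
      trans (sumMonomials-++ (fillerExponents j) _ e) (cong (_+ filler (suc j) e) (fillerExponents-sum j e))

    exponents : Vec ℤ (head ℕ.+ sum₁ s gap)
    exponents = exponentsFrom start head ++ fillerExponents s

    expr-exponents : ∀ e → expr s b k m e ≡ sumMonomials exponents e
    expr-exponents e = trans (expr-fillers e) (sym (trans (sumMonomials-++ (exponentsFrom start head) _ e)
      (cong (λ r → interval start head e + r) (fillerExponents-sum s e))))

    monomial-count : head ℕ.+ sum₁ s gap ≡ b (suc s)
    monomial-count = sym (ℕP.+-cancelˡ-≡ (sum₁ s b) _ _ (begin
        sum₁ s b ℕ.+ b (suc s)                      ≡⟨ length-total ⟩
        head ℕ.+ sum₁ s len                         ≡⟨ cong (head ℕ.+_) (sum₁-+ s β gap) ⟩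
        head ℕ.+ (sum₁ s β ℕ.+ sum₁ s gap)          ≡⟨ cong (λ x → head ℕ.+ (x ℕ.+ sum₁ s gap)) (reindex-sum₁ perm b) ⟩
        head ℕ.+ (sum₁ s b ℕ.+ sum₁ s gap)          ≡⟨ x∙yz≈y∙xz head (sum₁ s b) (sum₁ s gap) ⟩
        sum₁ s b ℕ.+ (head ℕ.+ sum₁ s gap)          ∎))

open import Data.Nat using (ℕ; suc; _+_; _∸_; _≤_; _<_)
open import Data.Integer using (ℤ; +_; _-_)
open import Data.Product using (Σ-syntax; _×_)
open import Data.Vec using (Vec)
open import Relation.Binary.PropositionalEquality using (_≡_)

proposition5p5 : (s : ℕ) → 1 ≤ s → (b k t w : ℕ → ℕ)
  → (∀ i → 1 ≤ i → i ≤ s → 1 ≤ k i × k i ≤ sum₁ (suc s) b)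
  → k 0 ≡ 0 → w 0 ≡ 0 → IsPermutation s w
  → (∀ j → 1 ≤ j → j ≤ s → (+ k (w j)) - (+ k (w (j ∸ 1))) ≡ + (b (w j) + t j))
  → sum₁ s t ≤ b (suc s)
  → (∀ j → 1 ≤ j → j ≤ s → w (j ∸ 1) < w j → 0 < t j)
  → (m : ℕ)
  → Σ[ ns ∈ Vec ℤ (b (suc s)) ] (∀ e → expr s b k m e ≡ sumMonomials ns e)
proposition5p5 s 1≤s b k t w k-bound _ w0 perm steps _ ascent m =
  resize monomial-count (expr s b k m) exponents expr-exponents
  where
  open Intervals using (resize)
  open Proposition.Proof s 1≤s b k t w k-bound w0 perm steps ascent m
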